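{- Let $B = \Theta(k/\log k)$ be an integer dividing $\sqrt{n}$, and let $\widehat{x} \in \mathbb{C}^{\sqrt{n}\times\sqrt{n}}$ be drawn from the Bernoulli model with parameter $k$. Say that two positions $(f_1,f_2), (f_1',f_2') \in [\sqrt{n}]^2$ superimpose if $f_1 = f_1'$ and $f_2 \equiv f_2' \pmod B$. Then the probability that there are more than $2$ positions in the support of $\widehat{x}$ that pairwise superimpose is at most $O\!\left(\frac{k\log^2 k}{n}\right)$.
   Context: Let $n$ be such that $\sqrt{n}$ is a power of $2$, and write $[m] = \{0,\dots,m-1\}$. Bernoulli model with parameter $k$ on $\widehat{x} \in \mathbb{C}^{\sqrt{n}\times\sqrt{n}}$: there is a fixed (unknown, arbitrary) matrix of values $(a_{i,j})$; independently for each $(i,j) \in [\sqrt{n}]^2$, with probability $k/n$ the entry $\widehat{x}_{i,j}$ equals $a_{i,j}$, and otherwise $\widehat{x}_{i,j}=0$. -}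

module Defs where

open import Data.Bool using (Bool; true; false; if_then_else_)
open import Data.Bool.Properties using () renaming (_≟_ to _≟B_)
open import Data.Nat using (ℕ; zero; suc; _*_; ∣_-_∣)
open import Data.Nat.Divisibility using (_∣_; _∣?_)
open import Data.Fin using (Fin; zero; suc; toℕ; combine)
open import Data.Fin.Properties using (any?) renaming (_≟_ to _≟F_)
open import Data.Product using (_×_; _,_; ∃; ∃-syntax; proj₁; proj₂)
open import Data.Product.Properties using (≡-dec)
open import Data.List using (List; []; _∷_; concatMap; foldr; map)
open import Data.Integer using (+_)
open import Data.Rational using (ℚ; 0ℚ; 1ℚ; _+_; _-_; _/_) renaming (_*_ to _*ℚ_)
open import Relation.Nullary using (Dec; yes; no; ¬_; ¬?)
open import Relation.Nullary.Decidable using (_×-dec_; ⌊_⌋; map′)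
open import Relation.Binary.PropositionalEquality using (_≡_; _≢_)

-- x / d as a rational, with the convention x / 0 = 0 (only used with d ≥ 1)
frac : ℕ → ℕ → ℚ
frac x zero    = 0ℚ
frac x (suc d) = (+ x) / suc d

-- all functions Fin N → Bool (the 2^N outcomes of N coin flips)
allBoolFns : (N : ℕ) → List (Fin N → Bool)
allBoolFns zero    = (λ ()) ∷ []
allBoolFns (suc N) = concatMap
  (λ f → (λ { zero → false ; (suc i) → f i }) ∷ (λ { zero → true ; (suc i) → f i }) ∷ [])
  (allBoolFns N)

prodFin : (N : ℕ) → (Fin N → ℚ) → ℚ
prodFin zero    g = 1ℚ
prodFin (suc N) g = g zero *ℚ prodFin N (λ i → g (suc i))

sumList : List ℚ → ℚ
sumList = foldr _+_ 0ℚ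

weight : (N : ℕ) → ℚ → (Fin N → Bool) → ℚ
weight N p ω = prodFin N (λ i → if ω i then p else (1ℚ - p))

-- Probability of a decidable event under the product Bernoulli(p) measure on Fin N → Bool
Pr : (N : ℕ) → ℚ → (E : (Fin N → Bool) → Set) → ((ω : Fin N → Bool) → Dec (E ω)) → ℚ
Pr N p E E? = sumList (map (λ ω → weight N p ω *ℚ (if ⌊ E? ω ⌋ then 1ℚ else 0ℚ)) (allBoolFns N))

Pos : ℕ → Set
Pos m = Fin m × Fin m

Superimpose : {m : ℕ} → ℕ → Pos m → Pos m → Set
Superimpose B (f1 , f2) (g1 , g2) = (f1 ≡ g1) × (B ∣ ∣ toℕ f2 - toℕ g2 ∣)

superimpose? : {m : ℕ} (B : ℕ) (p q : Pos m) → Dec (Superimpose B p q)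
superimpose? B (f1 , f2) (g1 , g2) = (f1 ≟F g1) ×-dec (B ∣? ∣ toℕ f2 - toℕ g2 ∣)

-- Random matrix x̂ : the coin ω (indexed by Fin (m*m) via combine) says whether entry (i,j)
-- is kept; a i j = true iff the fixed value a_{i,j} is nonzero.
-- position p is in the support of x̂ iff the coin is true and a_{p} ≠ 0.
InSupport : {m : ℕ} → (Fin m → Fin m → Bool) → (Fin (m * m) → Bool) → Pos m → Set
InSupport a ω (i , j) = (ω (combine i j) ≡ true) × (a i j ≡ true)

inSupport? : {m : ℕ} (a : Fin m → Fin m → Bool) (ω : Fin (m * m) → Bool) (p : Pos m) → Dec (InSupport a ω p)
inSupport? a ω (i , j) = (ω (combine i j) ≟B true) ×-dec (a i j ≟B true)

ThreeSuperimposing : {m : ℕ} → ℕ → (Fin m → Fin m → Bool) → (Fin (m * m) → Bool) → Set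
ThreeSuperimposing {m} B a ω = ∃[ p ] ∃[ q ] ∃[ r ]
  ( InSupport a ω p × InSupport a ω q × InSupport a ω r
  × p ≢ q × p ≢ r × q ≢ r
  × Superimpose B p q × Superimpose B p r × Superimpose B q r )

anyPos? : {m : ℕ} {P : Pos m → Set} → ((p : Pos m) → Dec (P p)) → Dec (∃ P)
anyPos? P? = map′ (λ { (i , j , x) → (i , j) , x }) (λ { ((i , j) , x) → i , j , x })
                  (any? (λ i → any? (λ j → P? (i , j))))

threeSuperimposing? : {m : ℕ} (B : ℕ) (a : Fin m → Fin m → Bool) (ω : Fin (m * m) → Bool)
  → Dec (ThreeSuperimposing B a ω)
threeSuperimposing? B a ω = anyPos? λ p → anyPos? λ q → anyPos? λ r →
  inSupport? a ω p ×-dec inSupport? a ω q ×-dec inSupport? a ω r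
  ×-dec ¬? (≡-dec _≟F_ _≟F_ p q) ×-dec ¬? (≡-dec _≟F_ _≟F_ p r) ×-dec ¬? (≡-dec _≟F_ _≟F_ q r)
  ×-dec superimpose? B p q ×-dec superimpose? B p r ×-dec superimpose? B q r

module Submission where

-- Proof idea (first-moment / union bound).  Write m = √n = 2^t, N = m·m coins and p = k/N;
-- the coin of position (i, j) decides whether the entry is kept.  If three distinct positions
-- P, Q, R of the support pairwise superimpose, then their three coins are true and Q, R
-- superimpose with P.  Summing over all such triples (P, Q, R),
--   Pr ≤ Σ_P Σ_{Q ~ P} Σ_{R ~ P} p³ ≤ m² · s² · p³,   where m = s·B,
-- since three given distinct coins are all true with probability exactly p³ and a position
-- superimposes with at most s positions (those in its row with the same column residue mod B).
-- Finally m² s² p³ = k³ / (B² m²) ≤ c² k log²k / m², using k ≤ c·B·log k.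

open import Defs
open import Algebra.Bundles using (CommutativeRing; CommutativeMonoid; Semiring)
open import Data.Bool using (Bool; true; false; if_then_else_)
open import Data.Empty using (⊥-elim)
open import Data.Fin as Fin using (Fin; zero; suc; toℕ; combine)
open import Data.Fin.Properties using (toℕ-injective; toℕ<n; combine-injective; suc-injective)
open import Data.Fin.Subset as Sub using (Subset; inside; outside; _∈_; ⁅_⁆; _∪_) renaming (∣_∣ to ∣_∣ˢ)
open import Data.Fin.Subset.Properties
  using (x∈⁅y⁆⇒x≡y; x∈⁅x⁆; p⊆p∪q; q⊆p∪q; x∈p∪q⁻; x∈p∧x≢y⇒x∈p-y; x∈p⇒∣p-x∣<∣p∣)
open import Data.Integer as ℤ using () renaming (+_ to pos)
import Data.Integer.Properties as ℤ
open import Data.Integer.Tactic.RingSolver using () renaming (solve-∀ to ℤ-solve-∀)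
open import Data.List using (List; []; _∷_; map; concatMap; _++_)
open import Data.List.Properties using (map-cong)
open import Data.Nat as ℕ using (ℕ; zero; suc; NonZero; ∣_-_∣; _%_; _∸_; z≤n; s≤s)
import Data.Nat.Properties as ℕ
import Data.Nat.Solver as ℕ-Solver
open import Data.Nat.Divisibility using (_∣_; _∣?_; divides; quotient; m∣n⇒n≡quotient*m; 0∣⇒≡0)
open import Data.Nat.Logarithm using (⌊log₂_⌋)
open import Data.Nat.DivMod using ([m+kn]%n≡m%n; [m+n]%n≡m%n; m<n⇒m%n≡m)
open import Data.Product using (_×_; _,_; ∃-syntax)
open import Data.Product.Properties using (≡-dec)
open import Data.Rational using (ℚ; 0ℚ; 1ℚ; _+_; _*_; _-_; -_; _≤_; toℚᵘ; nonNegative)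
open import Data.Rational.Properties
  using ( +-*-commutativeRing; ≤-refl; ≤-reflexive; ≤-trans; module ≤-Reasoning
        ; +-mono-≤; +-monoˡ-≤; +-monoʳ-≤; *-monoˡ-≤-nonNeg;  nonNegative⁻¹
        ; +-identityˡ; +-identityʳ; +-assoc; +-inverseʳ; *-zeroˡ; *-zeroʳ; *-identityʳ; *-distribˡ-+
        ; +-0-commutativeMonoid
        ; toℚᵘ-injective; toℚᵘ-fromℚᵘ; toℚᵘ-homo-+; toℚᵘ-homo-*; toℚᵘ-cancel-≤ )
open import Data.Rational.Solver using (module +-*-Solver)
open import Data.Rational.Unnormalised as ℚᵘ using (mkℚᵘ; *≡*; *≤*) renaming (_≃_ to _≃ᵘ_)
import Data.Rational.Unnormalised.Properties as ℚᵘ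
open import Data.Sum using (inj₁; inj₂)
open import Data.Vec.Base using ([]; _∷_; here; there)
open import Function using (_∘_)
open import Level using (0ℓ)
open import Relation.Nullary using (Dec; yes; no; ¬?; _×-dec_)
open import Relation.Nullary.Decidable using (⌊_⌋)
open import Relation.Binary.PropositionalEquality

ℚ-semiring : Semiring 0ℓ 0ℓ
ℚ-semiring = CommutativeRing.semiring +-*-commutativeRing

open import Algebra.Properties.Semiring.Sum ℚ-semiring
  using (sum; sum-syntax; sum-cong-≗; sum-replicate; sum-replicate-zero)
open import Algebra.Properties.CommutativeSemigroup (CommutativeMonoid.commutativeSemigroup +-0-commutativeMonoid)
  using () renaming (interchange to +-interchange)
open import Algebra.Definitions.RawSemiring (Semiring.rawSemiring ℚ-semiring)
  using (_^_) renaming (_×_ to _·_)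

frac-unnormalised : ∀ a d → toℚᵘ (frac a (suc d)) ≃ᵘ mkℚᵘ (pos a) d
frac-unnormalised a d = toℚᵘ-fromℚᵘ (mkℚᵘ (pos a) d)

frac-zero : ∀ d → frac 0 d ≡ 0ℚ
frac-zero zero    = refl
frac-zero (suc d) = toℚᵘ-injective (ℚᵘ.≃-trans (frac-unnormalised 0 d) (*≡* refl))

frac-+ : ∀ a b d → frac a d + frac b d ≡ frac (a ℕ.+ b) d
frac-+ a b zero    = refl
frac-+ a b (suc d) = toℚᵘ-injective (begin
  toℚᵘ (frac a (suc d) + frac b (suc d))
    ≈⟨ toℚᵘ-homo-+ (frac a (suc d)) (frac b (suc d)) ⟩
  toℚᵘ (frac a (suc d)) ℚᵘ.+ toℚᵘ (frac b (suc d))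
    ≈⟨ ℚᵘ.+-cong (frac-unnormalised a d) (frac-unnormalised b d) ⟩
  mkℚᵘ (pos a) d ℚᵘ.+ mkℚᵘ (pos b) d
    ≈⟨ *≡* (same-denominator a b (suc d)) ⟩
  mkℚᵘ (pos (a ℕ.+ b)) d
    ≈⟨ ℚᵘ.≃-sym (frac-unnormalised (a ℕ.+ b) d) ⟩
  toℚᵘ (frac (a ℕ.+ b) (suc d)) ∎)
  where
  open ℚᵘ.≃-Reasoning
  same-denominator : ∀ a b n → (pos a ℤ.* pos n ℤ.+ pos b ℤ.* pos n) ℤ.* pos n ≡ pos (a ℕ.+ b) ℤ.* pos (n ℕ.* n)
  same-denominator a b n = trans (ring (pos a) (pos b) (pos n)) (sym (cong₂ ℤ._*_ (ℤ.pos-+ a b) (ℤ.pos-* n n)))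
    where
    ring : ∀ x y z → (x ℤ.* z ℤ.+ y ℤ.* z) ℤ.* z ≡ (x ℤ.+ y) ℤ.* (z ℤ.* z)
    ring = ℤ-solve-∀

frac-* : ∀ a b d e → frac a d * frac b e ≡ frac (a ℕ.* b) (d ℕ.* e)
frac-* a b zero    e       = *-zeroˡ (frac b e)
frac-* a b (suc d) zero    = trans (*-zeroʳ (frac a (suc d))) (cong (frac (a ℕ.* b)) (sym (ℕ.*-zeroʳ (suc d))))
frac-* a b (suc d) (suc e) = toℚᵘ-injective (begin
  toℚᵘ (frac a (suc d) * frac b (suc e))
    ≈⟨ toℚᵘ-homo-* (frac a (suc d)) (frac b (suc e)) ⟩
  toℚᵘ (frac a (suc d)) ℚᵘ.* toℚᵘ (frac b (suc e))
    ≈⟨ ℚᵘ.*-cong (frac-unnormalised a d) (frac-unnormalised b e) ⟩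
  mkℚᵘ (pos a) d ℚᵘ.* mkℚᵘ (pos b) e
    ≈⟨ *≡* (cong (ℤ._* pos (suc d ℕ.* suc e)) (sym (ℤ.pos-* a b))) ⟩
  mkℚᵘ (pos (a ℕ.* b)) (e ℕ.+ d ℕ.* suc e)
    ≈⟨ ℚᵘ.≃-sym (frac-unnormalised (a ℕ.* b) (e ℕ.+ d ℕ.* suc e)) ⟩
  toℚᵘ (frac (a ℕ.* b) (suc d ℕ.* suc e)) ∎)
  where open ℚᵘ.≃-Reasoning

frac-mono : ∀ {a b d e} .{{_ : NonZero d}} .{{_ : NonZero e}} → a ℕ.* e ℕ.≤ b ℕ.* d → frac a d ≤ frac b e
frac-mono {a} {b} {suc d} {suc e} le = toℚᵘ-cancel-≤
  (ℚᵘ.≤-respʳ-≃ (ℚᵘ.≃-sym (frac-unnormalised b e)) (ℚᵘ.≤-respˡ-≃ (ℚᵘ.≃-sym (frac-unnormalised a d))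
    (*≤* (subst₂ ℤ._≤_ (ℤ.pos-* a (suc e)) (ℤ.pos-* b (suc d)) (ℤ.+≤+ le)))))

·-frac : ∀ n a d → n · frac a d ≡ frac (n ℕ.* a) d
·-frac zero    a d = sym (frac-zero d)
·-frac (suc n) a d = trans (cong (frac a d +_) (·-frac n a d)) (frac-+ a (n ℕ.* a) d)

^-frac : ∀ n a d → frac a d ^ n ≡ frac (a ℕ.^ n) (d ℕ.^ n)
^-frac zero    a d = refl
^-frac (suc n) a d = trans (cong (frac a d *_) (^-frac n a d)) (frac-* a (a ℕ.^ n) d (d ℕ.^ n))

0≤1 : 0ℚ ≤ 1ℚ
0≤1 = nonNegative⁻¹ 1ℚ

*-monoˡ-≤ : ∀ {r p q} → 0ℚ ≤ r → p ≤ q → r * p ≤ r * q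
*-monoˡ-≤ {r} 0≤r = *-monoˡ-≤-nonNeg r {{nonNegative 0≤r}}

1-p-nonNeg : ∀ {p} → p ≤ 1ℚ → 0ℚ ≤ 1ℚ - p
1-p-nonNeg {p} p≤1 = subst (_≤ 1ℚ - p) (+-inverseʳ p) (+-monoˡ-≤ (- p) p≤1)

^-nonNeg : ∀ {p} n → 0ℚ ≤ p → 0ℚ ≤ p ^ n
^-nonNeg zero    0≤p = 0≤1
^-nonNeg {p} (suc n) 0≤p = subst (_≤ p * p ^ n) (*-zeroʳ p) (*-monoˡ-≤ 0≤p (^-nonNeg n 0≤p))

^-antitone : ∀ {p m n} → 0ℚ ≤ p → p ≤ 1ℚ → m ℕ.≤ n → p ^ n ≤ p ^ m
^-antitone {n = zero}      0≤p p≤1 z≤n       = ≤-refl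
^-antitone {p} {n = suc n} 0≤p p≤1 z≤n       = begin
  p * p ^ n ≤⟨ *-monoˡ-≤ 0≤p (^-antitone {p} {0} {n} 0≤p p≤1 z≤n) ⟩
  p * 1ℚ    ≡⟨ *-identityʳ p ⟩
  p         ≤⟨ p≤1 ⟩
  1ℚ        ∎
  where open ≤-Reasoning
^-antitone {p}             0≤p p≤1 (s≤s m≤n) = *-monoˡ-≤ 0≤p (^-antitone 0≤p p≤1 m≤n)

ifYes : ∀ {A : Set} → Dec A → ℚ → ℚ
ifYes d x = if ⌊ d ⌋ then x else 0ℚ

module _ {A : Set} where

  ifYes-yes : ∀ (d : Dec A) {x} → A → ifYes d x ≡ x
  ifYes-yes (yes _) _ = refl
  ifYes-yes (no ¬a) a = ⊥-elim (¬a a)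

  ifYes-nonNeg : ∀ (d : Dec A) {x} → 0ℚ ≤ x → 0ℚ ≤ ifYes d x
  ifYes-nonNeg (yes _) 0≤x = 0≤x
  ifYes-nonNeg (no _)  _   = ≤-refl

  ifYes-mono : ∀ (d : Dec A) {x y} → x ≤ y → ifYes d x ≤ ifYes d y
  ifYes-mono (yes _) x≤y = x≤y
  ifYes-mono (no _)  _   = ≤-refl

  ifYes-×-dec : ∀ {B : Set} (d : Dec A) (e : Dec B) x → ifYes (d ×-dec e) x ≡ ifYes d (ifYes e x)
  ifYes-×-dec (yes _) (yes _) x = refl
  ifYes-×-dec (yes _) (no _)  x = refl
  ifYes-×-dec (no _)  e       x = refl

sum-mono : ∀ {n} {f g : Fin n → ℚ} → (∀ i → f i ≤ g i) → sum f ≤ sum g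
sum-mono {zero}          _   = ≤-refl
sum-mono {suc n} {f} {g} f≤g = +-mono-≤ (f≤g zero) (sum-mono {n} {f ∘ suc} {g ∘ suc} (f≤g ∘ suc))

module _ {n : ℕ} where

  sum-zero : ∀ {f : Fin n → ℚ} → (∀ i → f i ≡ 0ℚ) → sum f ≡ 0ℚ
  sum-zero f≡0 = trans (sum-cong-≗ f≡0) (sum-replicate-zero n)

  sum-nonNeg : ∀ {f : Fin n → ℚ} → (∀ i → 0ℚ ≤ f i) → 0ℚ ≤ sum f
  sum-nonNeg {f} 0≤f = subst (_≤ sum f) (sum-replicate-zero n) (sum-mono 0≤f)

  sum-ifYes : ∀ {A : Set} (d : Dec A) (f : Fin n → ℚ) → sum (λ i → ifYes d (f i)) ≡ ifYes d (sum f)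
  sum-ifYes (yes _) f = refl
  sum-ifYes (no _)  f = sum-zero (λ _ → refl)

·-nonNeg : ∀ n {x} → 0ℚ ≤ x → 0ℚ ≤ n · x
·-nonNeg n {x} 0≤x = subst (0ℚ ≤_) (sum-replicate n) (sum-nonNeg {n} {λ _ → x} (λ _ → 0≤x))

term≤sum : ∀ {n} (f : Fin n → ℚ) → (∀ i → 0ℚ ≤ f i) → ∀ i → f i ≤ sum f
term≤sum f 0≤f zero    = begin
  f zero              ≡⟨ +-identityʳ (f zero) ⟨
  f zero + 0ℚ         ≤⟨ +-monoʳ-≤ (f zero) (sum-nonNeg (0≤f ∘ suc)) ⟩
  f zero + sum (f ∘ suc) ∎
  where open ≤-Reasoning
term≤sum f 0≤f (suc i) = begin
  f (suc i)           ≤⟨ term≤sum (f ∘ suc) (0≤f ∘ suc) i ⟩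
  sum (f ∘ suc)       ≡⟨ +-identityˡ (sum (f ∘ suc)) ⟨
  0ℚ + sum (f ∘ suc)  ≤⟨ +-monoˡ-≤ (sum (f ∘ suc)) (0≤f zero) ⟩
  f zero + sum (f ∘ suc) ∎
  where open ≤-Reasoning

sum-atMostOne : ∀ {n} {P : Fin n → Set} (P? : ∀ i → Dec (P i)) → (∀ {i j} → P i → P j → i ≡ j)
  → (f : Fin n → ℚ) {y : ℚ} → (∀ i → f i ≤ y) → 0ℚ ≤ y → sum (λ i → ifYes (P? i) (f i)) ≤ y
sum-atMostOne {zero}  P? unique f f≤y 0≤y = 0≤y
sum-atMostOne {suc n} P? unique f {y} f≤y 0≤y with P? zero
... | yes P0 = begin
  f zero + sum (λ i → ifYes (P? (suc i)) (f (suc i))) ≡⟨ cong (f zero +_) (sum-zero others) ⟩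
  f zero + 0ℚ                                           ≡⟨ +-identityʳ (f zero) ⟩
  f zero                                                ≤⟨ f≤y zero ⟩
  y                                                     ∎
  where
  open ≤-Reasoning
  others : ∀ i → ifYes (P? (suc i)) (f (suc i)) ≡ 0ℚ
  others i with P? (suc i)
  ... | yes Pi = ⊥-elim (0≢1+n (unique P0 Pi))
    where 0≢1+n : zero ≢ suc i
          0≢1+n ()
  ... | no _   = refl
... | no _   = begin
  0ℚ + sum (λ i → ifYes (P? (suc i)) (f (suc i))) ≡⟨ +-identityˡ _ ⟩
  sum (λ i → ifYes (P? (suc i)) (f (suc i)))      ≤⟨ sum-atMostOne (P? ∘ suc) (λ Pi Pj → suc-injective (unique Pi Pj)) (f ∘ suc) (f≤y ∘ suc) 0≤y ⟩
  y                                               ∎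
  where open ≤-Reasoning

∑Pos : (m : ℕ) → (Pos m → ℚ) → ℚ
∑Pos m f = ∑[ i < m ] ∑[ j < m ] f (i , j)

module PosSums (m : ℕ) where

  ∑Pos-cong : ∀ {f g : Pos m → ℚ} → (∀ P → f P ≡ g P) → ∑Pos m f ≡ ∑Pos m g
  ∑Pos-cong f≡g = sum-cong-≗ (λ i → sum-cong-≗ (λ j → f≡g (i , j)))

  ∑Pos-mono : ∀ {f g : Pos m → ℚ} → (∀ P → f P ≤ g P) → ∑Pos m f ≤ ∑Pos m g
  ∑Pos-mono f≤g = sum-mono (λ i → sum-mono (λ j → f≤g (i , j)))

  ∑Pos-nonNeg : ∀ {f : Pos m → ℚ} → (∀ P → 0ℚ ≤ f P) → 0ℚ ≤ ∑Pos m f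
  ∑Pos-nonNeg 0≤f = sum-nonNeg (λ i → sum-nonNeg (λ j → 0≤f (i , j)))

  term≤∑Pos : ∀ (f : Pos m → ℚ) → (∀ P → 0ℚ ≤ f P) → ∀ P → f P ≤ ∑Pos m f
  term≤∑Pos f 0≤f (i , j) = ≤-trans (term≤sum (λ j → f (i , j)) (λ j → 0≤f (i , j)) j)
    (term≤sum (λ i → ∑[ j < m ] f (i , j)) (λ i → sum-nonNeg (λ j → 0≤f (i , j))) i)

  ∑Pos-ifYes : ∀ {A : Set} (d : Dec A) (f : Pos m → ℚ) → ∑Pos m (λ P → ifYes d (f P)) ≡ ifYes d (∑Pos m f)
  ∑Pos-ifYes d f = trans (sum-cong-≗ (λ i → sum-ifYes d (λ j → f (i , j))))
                         (sum-ifYes d (λ i → ∑[ j < m ] f (i , j)))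

  ∑Pos-const : ∀ x → ∑Pos m (λ _ → x) ≡ m · (m · x)
  ∑Pos-const x = trans (sum-cong-≗ {m} (λ _ → sum-replicate m {x})) (sum-replicate m {m · x})

rangeSum : ℕ → (ℕ → ℚ) → ℚ
rangeSum n h = ∑[ y < n ] h (toℕ y)

rangeSum-+ : ∀ a b h → rangeSum (a ℕ.+ b) h ≡ rangeSum a h + rangeSum b (λ y → h (a ℕ.+ y))
rangeSum-+ zero    b h = sym (+-identityˡ _)
rangeSum-+ (suc a) b h = trans (cong (h 0 +_) (rangeSum-+ a b (h ∘ suc))) (sym (+-assoc (h 0) _ _))

rangeSum-periodic : ∀ B s (h : ℕ → ℚ) {y} → (∀ z → h (B ℕ.+ z) ≡ h z) → rangeSum B h ≤ y
  → rangeSum (s ℕ.* B) h ≤ s · y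
rangeSum-periodic B zero    h periodic one-period = ≤-refl
rangeSum-periodic B (suc s) h {y} periodic one-period = begin
  rangeSum (B ℕ.+ s ℕ.* B) h                                ≡⟨ rangeSum-+ B (s ℕ.* B) h ⟩
  rangeSum B h + rangeSum (s ℕ.* B) (λ z → h (B ℕ.+ z))     ≡⟨ cong (rangeSum B h +_) (sum-cong-≗ {s ℕ.* B} (periodic ∘ toℕ)) ⟩
  rangeSum B h + rangeSum (s ℕ.* B) h                       ≤⟨ +-mono-≤ one-period (rangeSum-periodic B s h periodic one-period) ⟩
  y + s · y                                                 ∎
  where open ≤-Reasoning

-- Residues modulo B and the number of positions superimposing with a given one.

+multiple⇒%≡ : ∀ B {u v} .{{_ : NonZero B}} → u ℕ.≤ v → B ∣ v ∸ u → v % B ≡ u % B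
+multiple⇒%≡ B {u} {v} u≤v (divides q v∸u≡q*B) = begin
  v % B                 ≡⟨ cong (_% B) (ℕ.m+[n∸m]≡n u≤v) ⟨
  (u ℕ.+ (v ∸ u)) % B   ≡⟨ cong (λ w → (u ℕ.+ w) % B) v∸u≡q*B ⟩
  (u ℕ.+ q ℕ.* B) % B   ≡⟨ [m+kn]%n≡m%n u q B ⟩
  u % B                 ∎
  where open ≡-Reasoning

∣-∣-divisible⇒%≡ : ∀ B {x y} .{{_ : NonZero B}} → B ∣ ∣ x - y ∣ → x % B ≡ y % B
∣-∣-divisible⇒%≡ B {x} {y} B∣ with ℕ.≤-total x y
... | inj₁ x≤y = sym (+multiple⇒%≡ B x≤y (subst (B ∣_) (ℕ.m≤n⇒∣m-n∣≡n∸m x≤y) B∣))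
... | inj₂ y≤x = +multiple⇒%≡ B y≤x (subst (B ∣_) (trans (ℕ.∣-∣-comm x y) (ℕ.m≤n⇒∣m-n∣≡n∸m y≤x)) B∣)

%-injective-on-period : ∀ {B} .{{_ : NonZero B}} {i j : Fin B} → toℕ i % B ≡ toℕ j % B → i ≡ j
%-injective-on-period {B} {i} {j} i≡j = toℕ-injective (begin
  toℕ i      ≡⟨ m<n⇒m%n≡m (toℕ<n i) ⟨
  toℕ i % B  ≡⟨ i≡j ⟩
  toℕ j % B  ≡⟨ m<n⇒m%n≡m (toℕ<n j) ⟩
  toℕ j      ∎)
  where open ≡-Reasoning

row-count : ∀ B s J .{{_ : NonZero B}} {y} → 0ℚ ≤ y
  → rangeSum (s ℕ.* B) (λ z → ifYes (B ∣? ∣ J - z ∣) y) ≤ s · y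
row-count B s J {y} 0≤y = begin
  rangeSum (s ℕ.* B) (λ z → ifYes (B ∣? ∣ J - z ∣) y) ≤⟨ sum-mono {s ℕ.* B} (divisible≤sameResidue ∘ toℕ) ⟩
  rangeSum (s ℕ.* B) sameResidue                       ≤⟨ rangeSum-periodic B s sameResidue periodic one-period ⟩
  s · y                                                ∎
  where
  open ≤-Reasoning
  sameResidue : ℕ → ℚ
  sameResidue z = ifYes (z % B ℕ.≟ J % B) y

  divisible≤sameResidue : ∀ z → ifYes (B ∣? ∣ J - z ∣) y ≤ sameResidue z
  divisible≤sameResidue z with B ∣? ∣ J - z ∣
  ... | yes B∣ = ≤-reflexive (sym (ifYes-yes (z % B ℕ.≟ J % B) (sym (∣-∣-divisible⇒%≡ B B∣))))
  ... | no _   = ifYes-nonNeg (z % B ℕ.≟ J % B) 0≤y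

  periodic : ∀ z → sameResidue (B ℕ.+ z) ≡ sameResidue z
  periodic z = cong (λ r → ifYes (r ℕ.≟ J % B) y) (trans (cong (_% B) (ℕ.+-comm B z)) ([m+n]%n≡m%n z B))

  one-period : rangeSum B sameResidue ≤ y
  one-period = sum-atMostOne (λ i → toℕ i % B ℕ.≟ J % B)
    (λ i≡J j≡J → %-injective-on-period (trans i≡J (sym j≡J))) (λ _ → y) (λ _ → ≤-refl) 0≤y

-- If m = s·B, a position superimposes with at most s positions (those of its row with the
-- same column residue); weighted by y ≥ 0:
superimposing-count : ∀ {m} B s .{{_ : NonZero B}} → m ≡ s ℕ.* B → (P : Pos m) {y : ℚ} → 0ℚ ≤ y
  → ∑Pos m (λ Q → ifYes (superimpose? B P Q) y) ≤ s · y
superimposing-count B s refl (i , j) {y} 0≤y = begin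
  ∑[ i′ < s ℕ.* B ] ∑[ j′ < s ℕ.* B ] ifYes (superimpose? B (i , j) (i′ , j′)) y
    ≡⟨ sum-cong-≗ (λ i′ → trans (sum-cong-≗ (λ j′ → ifYes-×-dec (i Fin.≟ i′) (column? j′) y))
                                (sum-ifYes (i Fin.≟ i′) (λ j′ → ifYes (column? j′) y))) ⟩
  ∑[ i′ < s ℕ.* B ] ifYes (i Fin.≟ i′) rowSum
    ≤⟨ sum-atMostOne (i Fin.≟_) (λ i≡i′ i≡i″ → trans (sym i≡i′) i≡i″) (λ _ → rowSum)
                     (λ _ → row-count B s (toℕ j) 0≤y) (·-nonNeg s 0≤y) ⟩
  s · y ∎
  where
  open ≤-Reasoning
  column? : (j′ : Fin (s ℕ.* B)) → Dec (B ∣ ∣ toℕ j - toℕ j′ ∣)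
  column? j′ = B ∣? ∣ toℕ j - toℕ j′ ∣
  rowSum : ℚ
  rowSum = rangeSum (s ℕ.* B) (λ z → ifYes (B ∣? ∣ toℕ j - z ∣) y)

sumOver : ∀ {A : Set} → List A → (A → ℚ) → ℚ
sumOver L f = sumList (map f L)

module _ {A : Set} where

  sumOver-cong : ∀ (L : List A) {f g : A → ℚ} → (∀ x → f x ≡ g x) → sumOver L f ≡ sumOver L g
  sumOver-cong L f≡g = cong sumList (map-cong f≡g L)

  sumOver-mono : ∀ (L : List A) {f g : A → ℚ} → (∀ x → f x ≤ g x) → sumOver L f ≤ sumOver L g
  sumOver-mono []      _   = ≤-refl
  sumOver-mono (x ∷ L) f≤g = +-mono-≤ (f≤g x) (sumOver-mono L f≤g)

  sumOver-zero : ∀ (L : List A) → sumOver L (λ _ → 0ℚ) ≡ 0ℚ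
  sumOver-zero []      = refl
  sumOver-zero (x ∷ L) = trans (cong (0ℚ +_) (sumOver-zero L)) (+-identityˡ 0ℚ)

  sumOver-+ : ∀ (L : List A) (f g : A → ℚ) → sumOver L (λ x → f x + g x) ≡ sumOver L f + sumOver L g
  sumOver-+ []      f g = sym (+-identityˡ 0ℚ)
  sumOver-+ (x ∷ L) f g = trans (cong (f x + g x +_) (sumOver-+ L f g)) (+-interchange (f x) (g x) _ _)

  sumOver-scale : ∀ (L : List A) c (f : A → ℚ) → sumOver L (λ x → c * f x) ≡ c * sumOver L f
  sumOver-scale []      c f = sym (*-zeroʳ c)
  sumOver-scale (x ∷ L) c f = trans (cong (c * f x +_) (sumOver-scale L c f)) (sym (*-distribˡ-+ c (f x) _))

  sumOver-++ : ∀ (L L′ : List A) (f : A → ℚ) → sumOver (L ++ L′) f ≡ sumOver L f + sumOver L′ f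
  sumOver-++ []      L′ f = sym (+-identityˡ _)
  sumOver-++ (x ∷ L) L′ f = trans (cong (f x +_) (sumOver-++ L L′ f)) (sym (+-assoc (f x) _ _))

sumOver-concatMap : ∀ {A B : Set} (L : List A) (G : A → List B) (f : B → ℚ)
  → sumOver (concatMap G L) f ≡ sumOver L (λ x → sumOver (G x) f)
sumOver-concatMap []      G f = refl
sumOver-concatMap (x ∷ L) G f = trans (sumOver-++ (G x) (concatMap G L) f)
                                      (cong (sumOver (G x) f +_) (sumOver-concatMap L G f))

-- Expectation under the product Bernoulli(p) measure on N coins.  Pr N p E E? is, by
-- definition, the expectation of the indicator ifYes (E? ω) 1ℚ.
𝔼 : (N : ℕ) → ℚ → ((Fin N → Bool) → ℚ) → ℚ
𝔼 N p g = sumOver (allBoolFns N) (λ ω → weight N p ω * g ω)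

prodFin-nonNeg : ∀ N (g : Fin N → ℚ) → (∀ i → 0ℚ ≤ g i) → 0ℚ ≤ prodFin N g
prodFin-nonNeg zero    g 0≤g = 0≤1
prodFin-nonNeg (suc N) g 0≤g =
  subst (_≤ prodFin (suc N) g) (*-zeroʳ (g zero)) (*-monoˡ-≤ (0≤g zero) (prodFin-nonNeg N (g ∘ suc) (0≤g ∘ suc)))

weight-nonNeg : ∀ {p} → 0ℚ ≤ p → p ≤ 1ℚ → ∀ N ω → 0ℚ ≤ weight N p ω
weight-nonNeg {p} 0≤p p≤1 N ω = prodFin-nonNeg N _ (λ i → coin-nonNeg (ω i))
  where
  coin-nonNeg : ∀ b → 0ℚ ≤ (if b then p else 1ℚ - p)
  coin-nonNeg true  = 0≤p
  coin-nonNeg false = 1-p-nonNeg p≤1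

module Expectation (N : ℕ) (p : ℚ) where

  𝔼-mono : 0ℚ ≤ p → p ≤ 1ℚ → ∀ {f g} → (∀ ω → f ω ≤ g ω) → 𝔼 N p f ≤ 𝔼 N p g
  𝔼-mono 0≤p p≤1 f≤g = sumOver-mono (allBoolFns N) (λ ω → *-monoˡ-≤ (weight-nonNeg 0≤p p≤1 N ω) (f≤g ω))

  𝔼-zero : 𝔼 N p (λ _ → 0ℚ) ≡ 0ℚ
  𝔼-zero = trans (sumOver-cong (allBoolFns N) (λ ω → *-zeroʳ (weight N p ω))) (sumOver-zero (allBoolFns N))

  𝔼-+ : ∀ f g → 𝔼 N p (λ ω → f ω + g ω) ≡ 𝔼 N p f + 𝔼 N p g
  𝔼-+ f g = trans (sumOver-cong (allBoolFns N) (λ ω → *-distribˡ-+ (weight N p ω) (f ω) (g ω)))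
                  (sumOver-+ (allBoolFns N) _ _)

  𝔼-ifYes : ∀ {A : Set} (d : Dec A) g → 𝔼 N p (λ ω → ifYes d (g ω)) ≡ ifYes d (𝔼 N p g)
  𝔼-ifYes (yes _) g = refl
  𝔼-ifYes (no _)  g = 𝔼-zero

  𝔼-sum : ∀ {n} (h : Fin n → (Fin N → Bool) → ℚ) → 𝔼 N p (λ ω → ∑[ i < n ] h i ω) ≡ ∑[ i < n ] 𝔼 N p (h i)
  𝔼-sum {zero}  h = 𝔼-zero
  𝔼-sum {suc n} h = trans (𝔼-+ (h zero) (λ ω → ∑[ i < n ] h (suc i) ω)) (cong (𝔼 N p (h zero) +_) (𝔼-sum (h ∘ suc)))

  𝔼-∑Pos : ∀ {m} (h : Pos m → (Fin N → Bool) → ℚ) → 𝔼 N p (λ ω → ∑Pos m (λ P → h P ω)) ≡ ∑Pos m (λ P → 𝔼 N p (h P))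
  𝔼-∑Pos {m} h = trans (𝔼-sum (λ i ω → ∑[ j < m ] h (i , j) ω)) (sum-cong-≗ (λ i → 𝔼-sum (λ j → h (i , j))))

𝔼-first-coin : ∀ N p (G : Bool → (Fin N → Bool) → ℚ)
  → 𝔼 (suc N) p (λ ω → G (ω zero) (λ i → ω (suc i))) ≡ (1ℚ - p) * 𝔼 N p (G false) + p * 𝔼 N p (G true)
𝔼-first-coin N p G = begin
  𝔼 (suc N) p (λ ω → G (ω zero) (λ i → ω (suc i)))
    ≡⟨ sumOver-concatMap (allBoolFns N) _ _ ⟩
  sumOver L (λ f → (1ℚ - p) * w f * G false f + (p * w f * G true f + 0ℚ))
    ≡⟨ sumOver-cong L (λ f → regroup (1ℚ - p) p (w f) (G false f) (G true f)) ⟩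
  sumOver L (λ f → (1ℚ - p) * (w f * G false f) + p * (w f * G true f))
    ≡⟨ sumOver-+ L _ _ ⟩
  sumOver L (λ f → (1ℚ - p) * (w f * G false f)) + sumOver L (λ f → p * (w f * G true f))
    ≡⟨ cong₂ _+_ (sumOver-scale L (1ℚ - p) _) (sumOver-scale L p _) ⟩
  (1ℚ - p) * 𝔼 N p (G false) + p * 𝔼 N p (G true) ∎
  where
  open ≡-Reasoning
  L : List (Fin N → Bool)
  L = allBoolFns N
  w : (Fin N → Bool) → ℚ
  w = weight N p
  regroup : ∀ q p w g g′ → q * w * g + (p * w * g′ + 0ℚ) ≡ q * (w * g) + p * (w * g′)
  regroup = solve 5 (λ q p w g g′ → q :* w :* g :+ (p :* w :* g′ :+ con 0ℚ) := q :* (w :* g) :+ p :* (w :* g′)) refl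
    where open +-*-Solver

allTrue : ∀ {N} → Subset N → (Fin N → Bool) → ℚ
allTrue []            ω = 1ℚ
allTrue (outside ∷ S) ω = allTrue S (λ i → ω (suc i))
allTrue (inside ∷ S)  ω = if ω zero then allTrue S (λ i → ω (suc i)) else 0ℚ

allTrue-nonNeg : ∀ {N} (S : Subset N) ω → 0ℚ ≤ allTrue S ω
allTrue-nonNeg []            ω = 0≤1
allTrue-nonNeg (outside ∷ S) ω = allTrue-nonNeg S (ω ∘ suc)
allTrue-nonNeg (inside ∷ S)  ω with ω zero
... | true  = allTrue-nonNeg S (ω ∘ suc)
... | false = ≤-refl

allTrue-one : ∀ {N} (S : Subset N) ω → (∀ {x} → x ∈ S → ω x ≡ true) → allTrue S ω ≡ 1ℚ
allTrue-one []            ω allIn = refl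
allTrue-one (outside ∷ S) ω allIn = allTrue-one S (ω ∘ suc) (allIn ∘ there)
allTrue-one (inside ∷ S)  ω allIn rewrite allIn here = allTrue-one S (ω ∘ suc) (allIn ∘ there)

𝔼-allTrue : ∀ N p (S : Subset N) → 𝔼 N p (allTrue S) ≡ p ^ ∣ S ∣ˢ
𝔼-allTrue zero    p []            = refl
𝔼-allTrue (suc N) p (outside ∷ S) = begin
  𝔼 (suc N) p (allTrue (outside ∷ S))                   ≡⟨ 𝔼-first-coin N p (λ _ → allTrue S) ⟩
  (1ℚ - p) * 𝔼 N p (allTrue S) + p * 𝔼 N p (allTrue S) ≡⟨ cong (λ e → (1ℚ - p) * e + p * e) (𝔼-allTrue N p S) ⟩
  (1ℚ - p) * p ^ ∣ S ∣ˢ + p * p ^ ∣ S ∣ˢ                 ≡⟨ complementary p (p ^ ∣ S ∣ˢ) ⟩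
  p ^ ∣ S ∣ˢ                                            ∎
  where
  open ≡-Reasoning
  complementary : ∀ p e → (1ℚ - p) * e + p * e ≡ e
  complementary = solve 2 (λ p e → (con 1ℚ :- p) :* e :+ p :* e := e) refl
    where open +-*-Solver
𝔼-allTrue (suc N) p (inside ∷ S)  = begin
  𝔼 (suc N) p (allTrue (inside ∷ S))                     ≡⟨ 𝔼-first-coin N p (λ b f → if b then allTrue S f else 0ℚ) ⟩
  (1ℚ - p) * 𝔼 N p (λ _ → 0ℚ) + p * 𝔼 N p (allTrue S)   ≡⟨ cong₂ (λ z e → (1ℚ - p) * z + p * e) (Expectation.𝔼-zero N p) (𝔼-allTrue N p S) ⟩
  (1ℚ - p) * 0ℚ + p * p ^ ∣ S ∣ˢ                          ≡⟨ cong (_+ p * p ^ ∣ S ∣ˢ) (*-zeroʳ (1ℚ - p)) ⟩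
  0ℚ + p * p ^ ∣ S ∣ˢ                                     ≡⟨ +-identityˡ (p * p ^ ∣ S ∣ˢ) ⟩
  p ^ suc ∣ S ∣ˢ                                          ∎
  where open ≡-Reasoning

three-members⇒3≤∣S∣ : ∀ {N} {S : Subset N} {x y z} → x ∈ S → y ∈ S → z ∈ S
  → x ≢ y → x ≢ z → y ≢ z → 3 ℕ.≤ ∣ S ∣ˢ
three-members⇒3≤∣S∣ {S = S} {x} {y} {z} x∈S y∈S z∈S x≢y x≢z y≢z = begin
  3                                 ≤⟨ ℕ.m≤m+n 3 ∣ S Sub.- x Sub.- y Sub.- z ∣ˢ ⟩
  3 ℕ.+ ∣ S Sub.- x Sub.- y Sub.- z ∣ˢ ≤⟨ s≤s (s≤s (x∈p⇒∣p-x∣<∣p∣ z∈S-x-y)) ⟩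
  2 ℕ.+ ∣ S Sub.- x Sub.- y ∣ˢ        ≤⟨ s≤s (x∈p⇒∣p-x∣<∣p∣ y∈S-x) ⟩
  1 ℕ.+ ∣ S Sub.- x ∣ˢ                ≤⟨ x∈p⇒∣p-x∣<∣p∣ x∈S ⟩
  ∣ S ∣ˢ                              ∎
  where
  open ℕ.≤-Reasoning
  y∈S-x : y ∈ S Sub.- x
  y∈S-x = x∈p∧x≢y⇒x∈p-y y∈S (x≢y ∘ sym)
  z∈S-x-y : z ∈ S Sub.- x Sub.- y
  z∈S-x-y = x∈p∧x≢y⇒x∈p-y (x∈p∧x≢y⇒x∈p-y z∈S (x≢z ∘ sym)) (y≢z ∘ sym)

-- The union bound over superimposing triples, for a fixed matrix support pattern a.

module TripleBound {m : ℕ} (B : ℕ) (a : Fin m → Fin m → Bool) where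

  open PosSums m

  N : ℕ
  N = m ℕ.* m

  coin : Pos m → Fin N
  coin (i , j) = combine i j

  coin-injective : ∀ {P Q} → coin P ≡ coin Q → P ≡ Q
  coin-injective {i , j} {k , l} eq with combine-injective i j k l eq
  ... | refl , refl = refl

  -- a position in the support has its coin true (the values a are not needed for the bound)
  inSupport⇒coin : ∀ {ω} P → InSupport a ω P → ω (coin P) ≡ true
  inSupport⇒coin (i , j) (coin-true , _) = coin-true

  coinsOf : Pos m → Pos m → Pos m → Subset N
  coinsOf P Q R = ⁅ coin P ⁆ ∪ ⁅ coin Q ⁆ ∪ ⁅ coin R ⁆

  Distinct : Pos m → Pos m → Pos m → Set
  Distinct P Q R = P ≢ Q × P ≢ R × Q ≢ R

  distinct? : ∀ P Q R → Dec (Distinct P Q R)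
  distinct? P Q R = ¬? (P ≟ᴾ Q) ×-dec ¬? (P ≟ᴾ R) ×-dec ¬? (Q ≟ᴾ R)
    where
    _≟ᴾ_ : (P Q : Pos m) → Dec (P ≡ Q)
    _≟ᴾ_ = ≡-dec Fin._≟_ Fin._≟_

  distinct⇒3≤∣coinsOf∣ : ∀ {P Q R} → Distinct P Q R → 3 ℕ.≤ ∣ coinsOf P Q R ∣ˢ
  distinct⇒3≤∣coinsOf∣ {P} {Q} {R} (P≢Q , P≢R , Q≢R) = three-members⇒3≤∣S∣
    (p⊆p∪q (⁅ coin Q ⁆ ∪ ⁅ coin R ⁆) (x∈⁅x⁆ (coin P)))
    (q⊆p∪q ⁅ coin P ⁆ _ (p⊆p∪q ⁅ coin R ⁆ (x∈⁅x⁆ (coin Q))))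
    (q⊆p∪q ⁅ coin P ⁆ _ (q⊆p∪q ⁅ coin Q ⁆ ⁅ coin R ⁆ (x∈⁅x⁆ (coin R))))
    (P≢Q ∘ coin-injective) (P≢R ∘ coin-injective) (Q≢R ∘ coin-injective)

  inSupport⇒coinsOf : ∀ {ω P Q R} → InSupport a ω P → InSupport a ω Q → InSupport a ω R
    → ∀ {x} → x ∈ coinsOf P Q R → ω x ≡ true
  inSupport⇒coinsOf {ω} {P} {Q} {R} inP inQ inR {x} x∈PQR with x∈p∪q⁻ ⁅ coin P ⁆ _ x∈PQR
  ... | inj₁ x∈P  = subst (λ y → ω y ≡ true) (sym (x∈⁅y⁆⇒x≡y _ x∈P)) (inSupport⇒coin {ω} P inP)
  ... | inj₂ x∈QR with x∈p∪q⁻ ⁅ coin Q ⁆ ⁅ coin R ⁆ x∈QR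
  ...   | inj₁ x∈Q = subst (λ y → ω y ≡ true) (sym (x∈⁅y⁆⇒x≡y _ x∈Q)) (inSupport⇒coin {ω} Q inQ)
  ...   | inj₂ x∈R = subst (λ y → ω y ≡ true) (sym (x∈⁅y⁆⇒x≡y _ x∈R)) (inSupport⇒coin {ω} R inR)

  triple : Pos m → Pos m → Pos m → (Fin N → Bool) → ℚ
  triple P Q R ω = ifYes (superimpose? B P Q) (ifYes (superimpose? B P R)
                     (ifYes (distinct? P Q R) (allTrue (coinsOf P Q R) ω)))

  triple-nonNeg : ∀ P Q R ω → 0ℚ ≤ triple P Q R ω
  triple-nonNeg P Q R ω = ifYes-nonNeg (superimpose? B P Q) (ifYes-nonNeg (superimpose? B P R)
                            (ifYes-nonNeg (distinct? P Q R) (allTrue-nonNeg (coinsOf P Q R) ω)))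

  ∑triples : (Fin N → Bool) → ℚ
  ∑triples ω = ∑Pos m (λ P → ∑Pos m (λ Q → ∑Pos m (λ R → triple P Q R ω)))

  -- Pointwise union bound: whenever the event occurs, its witness contributes a term 1.
  indicator≤∑triples : ∀ ω → ifYes (threeSuperimposing? B a ω) 1ℚ ≤ ∑triples ω
  indicator≤∑triples ω with threeSuperimposing? B a ω
  ... | no _ = ∑Pos-nonNeg (λ P → ∑Pos-nonNeg (λ Q → ∑Pos-nonNeg (λ R → triple-nonNeg P Q R ω)))
  ... | yes (P , Q , R , inP , inQ , inR , P≢Q , P≢R , Q≢R , P~Q , P~R , _) = begin
    1ℚ                                  ≡⟨ triple≡1 ⟨
    triple P Q R ω                      ≤⟨ term≤∑Pos (λ R → triple P Q R ω) (λ R → triple-nonNeg P Q R ω) R ⟩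
    ∑Pos m (λ R → triple P Q R ω)         ≤⟨ term≤∑Pos (λ Q → ∑Pos m (λ R → triple P Q R ω))
                                             (λ Q → ∑Pos-nonNeg (λ R → triple-nonNeg P Q R ω)) Q ⟩
    ∑Pos m (λ Q → ∑Pos m (λ R → triple P Q R ω))
                                        ≤⟨ term≤∑Pos (λ P → ∑Pos m (λ Q → ∑Pos m (λ R → triple P Q R ω)))
                                             (λ P → ∑Pos-nonNeg (λ Q → ∑Pos-nonNeg (λ R → triple-nonNeg P Q R ω))) P ⟩
    ∑triples ω                          ∎
    where
    open ≤-Reasoning
    triple≡1 : triple P Q R ω ≡ 1ℚ
    triple≡1 = trans (ifYes-yes (superimpose? B P Q) P~Q) (trans (ifYes-yes (superimpose? B P R) P~R)
                 (trans (ifYes-yes (distinct? P Q R) (P≢Q , P≢R , Q≢R))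
                        (allTrue-one (coinsOf P Q R) ω (inSupport⇒coinsOf inP inQ inR))))

  𝔼-triple : ∀ {p} → 0ℚ ≤ p → p ≤ 1ℚ → ∀ P Q R
    → 𝔼 N p (triple P Q R) ≤ ifYes (superimpose? B P Q) (ifYes (superimpose? B P R) (p ^ 3))
  𝔼-triple {p} 0≤p p≤1 P Q R = begin
    𝔼 N p (triple P Q R)
      ≡⟨ trans (𝔼-ifYes P~Q _) (cong (ifYes P~Q) (trans (𝔼-ifYes P~R _) (cong (ifYes P~R) (𝔼-ifYes (distinct? P Q R) _)))) ⟩
    ifYes P~Q (ifYes P~R (ifYes (distinct? P Q R) (𝔼 N p (allTrue (coinsOf P Q R)))))
      ≤⟨ ifYes-mono P~Q (ifYes-mono P~R distinct-bound) ⟩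
    ifYes P~Q (ifYes P~R (p ^ 3)) ∎
    where
    open ≤-Reasoning
    open Expectation N p
    P~Q : Dec (Superimpose B P Q)
    P~Q = superimpose? B P Q
    P~R : Dec (Superimpose B P R)
    P~R = superimpose? B P R
    distinct-bound : ifYes (distinct? P Q R) (𝔼 N p (allTrue (coinsOf P Q R))) ≤ p ^ 3
    distinct-bound with distinct? P Q R
    ... | yes distinct = subst (_≤ p ^ 3) (sym (𝔼-allTrue N p (coinsOf P Q R)))
                               (^-antitone 0≤p p≤1 (distinct⇒3≤∣coinsOf∣ distinct))
    ... | no _         = ^-nonNeg 3 0≤p

  three-superimposing-bound : ∀ s .{{_ : NonZero B}} → m ≡ s ℕ.* B → ∀ {p} → 0ℚ ≤ p → p ≤ 1ℚ
    → Pr N p (ThreeSuperimposing B a) (threeSuperimposing? B a) ≤ m · (m · (s · (s · p ^ 3)))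
  three-superimposing-bound s m≡sB {p} 0≤p p≤1 = begin
    Pr N p (ThreeSuperimposing B a) (threeSuperimposing? B a)
      ≤⟨ 𝔼-mono 0≤p p≤1 indicator≤∑triples ⟩
    𝔼 N p ∑triples
      ≡⟨ 𝔼-∑triples ⟩
    ∑Pos m (λ P → ∑Pos m (λ Q → ∑Pos m (λ R → 𝔼 N p (triple P Q R))))
      ≤⟨ ∑Pos-mono (λ P → ∑Pos-mono (λ Q → ∑Pos-mono (λ R → 𝔼-triple 0≤p p≤1 P Q R))) ⟩
    ∑Pos m (λ P → ∑Pos m (λ Q → ∑Pos m (λ R → ifYes (superimpose? B P Q) (ifYes (superimpose? B P R) (p ^ 3)))))
      ≡⟨ ∑Pos-cong (λ P → ∑Pos-cong (λ Q → ∑Pos-ifYes (superimpose? B P Q) (λ R → ifYes (superimpose? B P R) (p ^ 3)))) ⟩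
    ∑Pos m (λ P → ∑Pos m (λ Q → ifYes (superimpose? B P Q) (∑Pos m (λ R → ifYes (superimpose? B P R) (p ^ 3)))))
      ≤⟨ ∑Pos-mono (λ P → ∑Pos-mono (λ Q → ifYes-mono (superimpose? B P Q)
           (superimposing-count B s m≡sB P (^-nonNeg 3 0≤p)))) ⟩
    ∑Pos m (λ P → ∑Pos m (λ Q → ifYes (superimpose? B P Q) (s · p ^ 3)))
      ≤⟨ ∑Pos-mono (λ P → superimposing-count B s m≡sB P (·-nonNeg s (^-nonNeg 3 0≤p))) ⟩
    ∑Pos m (λ _ → s · (s · p ^ 3))
      ≡⟨ ∑Pos-const (s · (s · p ^ 3)) ⟩
    m · (m · (s · (s · p ^ 3))) ∎
    where
    open ≤-Reasoning
    open Expectation N p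
    𝔼-∑triples : 𝔼 N p ∑triples ≡ ∑Pos m (λ P → ∑Pos m (λ Q → ∑Pos m (λ R → 𝔼 N p (triple P Q R))))
    𝔼-∑triples = trans (𝔼-∑Pos (λ P ω → ∑Pos m (λ Q → ∑Pos m (λ R → triple P Q R ω))))
      (∑Pos-cong (λ P → trans (𝔼-∑Pos (λ Q ω → ∑Pos m (λ R → triple P Q R ω)))
                              (∑Pos-cong (λ Q → 𝔼-∑Pos (λ R → triple P Q R)))))

-- With m = s·B and k ≤ c·B·L:  m²s²k³ · m² ≤ c²kL² · (m²)³; both sides share the factor k·s²·m⁴,
-- which leaves k² ≤ (c·B·L)².
counting-inequality : ∀ {m} c k s B L → m ≡ s ℕ.* B → k ℕ.≤ c ℕ.* (B ℕ.* L)
  → m ℕ.* (m ℕ.* (s ℕ.* (s ℕ.* k ℕ.^ 3))) ℕ.* (m ℕ.* m) ℕ.≤ c ℕ.* c ℕ.* k ℕ.* L ℕ.^ 2 ℕ.* (m ℕ.* m) ℕ.^ 3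
counting-inequality c k s B L refl k≤cBL = begin
  m ℕ.* (m ℕ.* (s ℕ.* (s ℕ.* k ℕ.^ 3))) ℕ.* (m ℕ.* m) ≡⟨ left m s k ⟩
  k ℕ.* k ℕ.* common                                  ≤⟨ ℕ.*-monoˡ-≤ common (ℕ.*-mono-≤ k≤cBL k≤cBL) ⟩
  c ℕ.* (B ℕ.* L) ℕ.* (c ℕ.* (B ℕ.* L)) ℕ.* common    ≡⟨ right c B L k s ⟩
  c ℕ.* c ℕ.* k ℕ.* L ℕ.^ 2 ℕ.* (m ℕ.* m) ℕ.^ 3       ∎
  where
  open ℕ.≤-Reasoning
  open ℕ-Solver.+-*-Solver
  m common : ℕ
  m = s ℕ.* B
  common = k ℕ.* (s ℕ.* s) ℕ.* (m ℕ.* m ℕ.* (m ℕ.* m))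
  left : ∀ m s k → m ℕ.* (m ℕ.* (s ℕ.* (s ℕ.* k ℕ.^ 3))) ℕ.* (m ℕ.* m)
                   ≡ k ℕ.* k ℕ.* (k ℕ.* (s ℕ.* s) ℕ.* (m ℕ.* m ℕ.* (m ℕ.* m)))
  left = solve 3 (λ m s k → m :* (m :* (s :* (s :* k :^ 3))) :* (m :* m)
                            := k :* k :* (k :* (s :* s) :* (m :* m :* (m :* m)))) refl
  right : ∀ c B L k s → let m = s ℕ.* B in
    c ℕ.* (B ℕ.* L) ℕ.* (c ℕ.* (B ℕ.* L)) ℕ.* (k ℕ.* (s ℕ.* s) ℕ.* (m ℕ.* m ℕ.* (m ℕ.* m)))
      ≡ c ℕ.* c ℕ.* k ℕ.* L ℕ.^ 2 ℕ.* (m ℕ.* m) ℕ.^ 3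
  right = solve 5 (λ c B L k s → let m = s :* B in
                     c :* (B :* L) :* (c :* (B :* L)) :* (k :* (s :* s) :* (m :* m :* (m :* m)))
                     := c :* c :* k :* L :^ 2 :* (m :* m) :^ 3) refl

divisor-nonZero : ∀ {B n} .{{_ : NonZero n}} → B ∣ n → NonZero B
divisor-nonZero {n = n} B∣n = ℕ.≢-nonZero (λ { refl → ℕ.≢-nonZero⁻¹ n (0∣⇒≡0 B∣n) })

superimposition-bound : ∀ {m} c k s B L (a : Fin m → Fin m → Bool) .{{_ : NonZero m}} .{{_ : NonZero B}}
  → m ≡ s ℕ.* B → k ℕ.≤ m ℕ.* m → k ℕ.≤ c ℕ.* (B ℕ.* L)
  → Pr (m ℕ.* m) (frac k (m ℕ.* m)) (ThreeSuperimposing B a) (threeSuperimposing? B a)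
      ≤ frac (c ℕ.* c ℕ.* k ℕ.* L ℕ.^ 2) (m ℕ.* m)
superimposition-bound {m} c k s B L a m≡sB k≤N k≤cBL = begin
  Pr N p (ThreeSuperimposing B a) (threeSuperimposing? B a)
    ≤⟨ TripleBound.three-superimposing-bound B a s m≡sB 0≤p p≤1 ⟩
  m · (m · (s · (s · p ^ 3)))
    ≡⟨ cong (λ q → m · (m · (s · (s · q)))) (^-frac 3 k N) ⟩
  m · (m · (s · (s · frac (k ℕ.^ 3) (N ℕ.^ 3))))
    ≡⟨ cong (λ q → m · (m · (s · q))) (·-frac s (k ℕ.^ 3) (N ℕ.^ 3)) ⟩
  m · (m · (s · frac (s ℕ.* k ℕ.^ 3) (N ℕ.^ 3)))
    ≡⟨ cong (λ q → m · (m · q)) (·-frac s (s ℕ.* k ℕ.^ 3) (N ℕ.^ 3)) ⟩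
  m · (m · frac (s ℕ.* (s ℕ.* k ℕ.^ 3)) (N ℕ.^ 3))
    ≡⟨ trans (cong (m ·_) (·-frac m _ (N ℕ.^ 3))) (·-frac m _ (N ℕ.^ 3)) ⟩
  frac (m ℕ.* (m ℕ.* (s ℕ.* (s ℕ.* k ℕ.^ 3)))) (N ℕ.^ 3)
    ≤⟨ frac-mono {d = N ℕ.^ 3} {e = N} (counting-inequality c k s B L m≡sB k≤cBL) ⟩
  frac (c ℕ.* c ℕ.* k ℕ.* L ℕ.^ 2) N ∎
  where
  open ≤-Reasoning
  N : ℕ
  N = m ℕ.* m
  p : ℚ
  p = frac k N
  instance
    N≢0 : NonZero N
    N≢0 = ℕ.m*n≢0 m m
    N³≢0 : NonZero (N ℕ.^ 3)
    N³≢0 = ℕ.m^n≢0 N 3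
  0≤p : 0ℚ ≤ p
  0≤p = frac-mono {0} {k} {1} {N} z≤n
  p≤1 : p ≤ 1ℚ
  p≤1 = frac-mono {k} {1} {N} {1} (subst₂ ℕ._≤_ (sym (ℕ.*-identityʳ k)) (sym (ℕ.*-identityˡ N)) k≤N)

-- Lemma 15, with √n = m = 2^t, B = Θ(k / log k) and the bound O(k log² k / n) with constant c².
-- Only the upper bound k ≤ c·B·log k of B = Θ(k / log k) is needed.
lemma15 : (c : ℕ) → ∃[ C ] ((t k B : ℕ) (a : Fin (2 ℕ.^ t) → Fin (2 ℕ.^ t) → Bool)
    → k ℕ.≤ 2 ℕ.^ t ℕ.* 2 ℕ.^ t
    → B ∣ 2 ℕ.^ t
    → k ℕ.≤ c ℕ.* (B ℕ.* ⌊log₂ k ⌋)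
    → B ℕ.* ⌊log₂ k ⌋ ℕ.≤ c ℕ.* k
    → Pr (2 ℕ.^ t ℕ.* 2 ℕ.^ t) (frac k (2 ℕ.^ t ℕ.* 2 ℕ.^ t)) (ThreeSuperimposing B a) (threeSuperimposing? B a)
        ≤ frac (C ℕ.* k ℕ.* ⌊log₂ k ⌋ ℕ.^ 2) (2 ℕ.^ t ℕ.* 2 ℕ.^ t))
lemma15 c = c ℕ.* c , λ t k B a k≤n B∣m k≤cBL _ →
  let instance m≢0 = ℕ.m^n≢0 2 t
               B≢0 = divisor-nonZero B∣m
  in superimposition-bound c k (quotient B∣m) B ⌊log₂ k ⌋ a (m∣n⇒n≡quotient*m B∣m) k≤n k≤cBL
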